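{- Let $(O,\perp)$ be an orthoset. Then $(O,\perp)$ is compatible if and only if $L(O,\perp)$ is a Boolean algebra.
   Context: An orthoset $(O,\perp)$ is a set $O$ with an irreflexive symmetric binary relation $\perp$. For $X\subseteq O$, $X^\perp=\{y\in O\mid y\perp x \text{ for all } x\in X\}$, and $x^\perp=\{x\}^\perp$. A subset $X$ is orthoclosed if $X=X^{\perp\perp}$. $L(O,\perp)$ denotes the complete ortholattice of all orthoclosed subsets of $O$ ordered by inclusion, with meet given by intersection, join $X\vee Y=(X\cup Y)^{\perp\perp}$, and orthocomplement $X\mapsto X^\perp$. The orthoset is called compatible if for all $x,y\in O$ with $x\not\perp y$ there exists $z\in O$ such that $x^\perp\cup y^\perp\subseteq z^\perp$. A Boolean algebra is an ortholattice satisfying the distributive law. -}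

module Defs where

open import Level using (Level; _⊔_) renaming (suc to lsuc)
open import Data.Product using (Σ; ∃; _,_; proj₁; proj₂)
open import Data.Sum using (inj₁; inj₂)
open import Data.Empty using (⊥-elim)
open import Relation.Nullary using (¬_)
open import Relation.Unary using (Pred; _∈_; _⊆_; _≐_; _∪_; _∩_; ｛_｝)
open import Data.Unit.Polymorphic using (⊤)
open import Data.Empty.Polymorphic using () renaming (⊥ to Empty)
open import Algebra.Lattice.Structures using (IsBooleanAlgebra)

record Orthoset (ℓ : Level) : Set (lsuc ℓ) where
  field
    Carrier : Set ℓ
    _⊥_     : Carrier → Carrier → Set ℓ
    ⊥-irrefl : ∀ x → ¬ (x ⊥ x)
    ⊥-sym    : ∀ {x y} → x ⊥ y → y ⊥ x

module _ {ℓ : Level} (O : Orthoset ℓ) where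
  open Orthoset O

  _ᵖ : Pred Carrier ℓ → Pred Carrier ℓ
  (X ᵖ) y = ∀ {x} → x ∈ X → y ⊥ x

  pt⊥ : Carrier → Pred Carrier ℓ
  pt⊥ x = ｛ x ｝ ᵖ

  Orthoclosed : Pred Carrier ℓ → Set ℓ
  Orthoclosed X = X ≐ ((X ᵖ) ᵖ)

  Compatible : Set ℓ
  Compatible = ∀ x y → ¬ (x ⊥ y) → ∃ λ z → (pt⊥ x ∪ pt⊥ y) ⊆ pt⊥ z

  ᵖ-anti : ∀ {X Y : Pred Carrier ℓ} → X ⊆ Y → (Y ᵖ) ⊆ (X ᵖ)
  ᵖ-anti X⊆Y y∈Yᵖ x∈X = y∈Yᵖ (X⊆Y x∈X)

  ⊆ᵖᵖ : ∀ {X : Pred Carrier ℓ} → X ⊆ ((X ᵖ) ᵖ)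
  ⊆ᵖᵖ x∈X y∈Xᵖ = ⊥-sym (y∈Xᵖ x∈X)

  ᵖ-closed : ∀ (X : Pred Carrier ℓ) → Orthoclosed (X ᵖ)
  ᵖ-closed X = ⊆ᵖᵖ , ᵖ-anti ⊆ᵖᵖ

  L : Set (lsuc ℓ)
  L = Σ (Pred Carrier ℓ) Orthoclosed

  _≈L_ : L → L → Set ℓ
  A ≈L B = proj₁ A ≐ proj₁ B

  _∧L_ : L → L → L
  (X , cX) ∧L (Y , cY) = (X ∩ Y) , ⊆ᵖᵖ ,
    λ p → proj₂ cX (ᵖ-anti (ᵖ-anti proj₁) p) , proj₂ cY (ᵖ-anti (ᵖ-anti proj₂) p)

  _∨L_ : L → L → L
  (X , _) ∨L (Y , _) = ((X ∪ Y) ᵖ) ᵖ , ᵖ-closed ((X ∪ Y) ᵖ)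

  ¬L : L → L
  ¬L (X , _) = X ᵖ , ᵖ-closed X

  ⊤L : L
  ⊤L = (λ _ → ⊤) , ⊆ᵖᵖ , (λ _ → _)

  ⊥L : L
  ⊥L = (λ _ → Empty) , ⊆ᵖᵖ , (λ {x} p → ⊥-elim (⊥-irrefl x (p {x} (λ ()))))

  IsBooleanL : Set (lsuc ℓ)
  IsBooleanL = IsBooleanAlgebra _≈L_ _∨L_ _∧L_ ¬L ⊤L ⊥L

-- Both conditions are equivalent to: disjoint orthoclosed sets are orthogonal.
-- For compatibility this is a reformulation, since x^⊥ ⊆ z^⊥ says z ∈ {x}^⊥⊥;
-- excluded middle is used to decide x ⊥ y and to produce the witness z.
-- If disjoint elements of L are orthogonal, then for T = A ∧ (B ∨ C) and
-- D = (A ∧ B) ∨ (A ∧ C) the element T ∧ D^⊥ is orthogonal to B and to C, hence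
-- to B ∨ C ≥ T ∧ D^⊥, so it is empty and T ≤ D^⊥⊥ = D; the other distributive
-- law and the complement laws are general ortholattice facts.  Conversely in a
-- Boolean algebra A ∧ B = 0 gives A = (A ∧ B) ∨ (A ∧ B^⊥) ≤ B^⊥.
module Submission where

open import Level using (Level) renaming (suc to lsuc)
open import Axiom.ExcludedMiddle using (ExcludedMiddle)
open import Function.Base using (id; _∘_)
open import Function.Bundles using (_⇔_; mk⇔)
open import Data.Product using (_,_; proj₁; proj₂; swap)
open import Data.Sum using (inj₁; inj₂; [_,_])
open import Data.Empty using (⊥-elim)
open import Relation.Nullary using (yes; no)
open import Relation.Unary using (Pred; Empty; _∈_; _⊆_; _∪_; _∩_; ｛_｝)
open import Relation.Binary.PropositionalEquality using (refl)
open import Relation.Binary.Structures using (IsPartialOrder)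
open import Relation.Binary.Lattice using (Lattice; DistributiveLattice)
open import Algebra.Lattice.Structures using (IsBooleanAlgebra)
import Algebra.Lattice.Structures.Biased as Biased
import Relation.Binary.Lattice.Properties.Lattice as LatticeProperties
import Relation.Binary.Lattice.Properties.DistributiveLattice as DistributiveLatticeProperties
import Defs
open Defs hiding (_ᵖ)

module _ {ℓ : Level} (O : Orthoset ℓ) where
  open Orthoset O

  _ᵖ : Pred Carrier ℓ → Pred Carrier ℓ
  _ᵖ = Defs._ᵖ O

  infix 4 _≤_
  _≤_ : L O → L O → Set ℓ
  A ≤ B = proj₁ A ⊆ proj₁ B

  ∩ᵖ-empty : ∀ X → Empty (X ∩ X ᵖ)
  ∩ᵖ-empty X x (x∈X , x∈Xᵖ) = ⊥-irrefl x (x∈Xᵖ x∈X)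

  ᵖ-∪ᵖ-empty : ∀ X → Empty ((X ∪ X ᵖ) ᵖ)
  ᵖ-∪ᵖ-empty X x x∈[X∪Xᵖ]ᵖ = ∩ᵖ-empty (X ᵖ) x (x∈[X∪Xᵖ]ᵖ ∘ inj₁ , x∈[X∪Xᵖ]ᵖ ∘ inj₂)

  ᵖᵖ-least : ∀ {X} (A : L O) → X ⊆ proj₁ A → (X ᵖ) ᵖ ⊆ proj₁ A
  ᵖᵖ-least (_ , _ , closed) X⊆A = closed ∘ ᵖ-anti O (ᵖ-anti O X⊆A)

  ≤-isPartialOrder : IsPartialOrder (_≈L_ O) _≤_
  ≤-isPartialOrder = record
    { isPreorder = record
      { isEquivalence = record
        { refl  = id , id
        ; sym   = swap
        ; trans = λ (f , f′) (g , g′) → g ∘ f , f′ ∘ g′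
        }
      ; reflexive = proj₁
      ; trans     = λ f g → g ∘ f
      }
    ; antisym = _,_
    }

  lattice : Lattice (lsuc ℓ) ℓ ℓ
  lattice = record
    { Carrier   = L O
    ; _≈_       = _≈L_ O
    ; _≤_       = _≤_
    ; _∨_       = _∨L_ O
    ; _∧_       = _∧L_ O
    ; isLattice = record
      { isPartialOrder = ≤-isPartialOrder
      ; supremum       = λ _ _ → ⊆ᵖᵖ O ∘ inj₁ , ⊆ᵖᵖ O ∘ inj₂ ,
                                 λ C A≤C B≤C → ᵖᵖ-least C [ A≤C , B≤C ]
      ; infimum        = λ _ _ → proj₁ , proj₂ , λ _ C≤A C≤B x → C≤A x , C≤B x
      }
    }

  open Lattice lattice using (_∧_; _∨_; x≤x∨y; y≤x∨y; ∨-least; x∧y≤y)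

  DisjointOrthogonal : Set (lsuc ℓ)
  DisjointOrthogonal = ∀ (A B : L O) → Empty (proj₁ A ∩ proj₁ B) → A ≤ ¬L O B

  principal : Carrier → L O
  principal x = ¬L O (pt⊥ O x , ᵖ-closed O ｛ x ｝)

  ∈principal : ∀ x → x ∈ proj₁ (principal x)
  ∈principal x = ⊆ᵖᵖ O refl

  ∈principal⇒pt⊥-⊆ : ∀ {x z} → z ∈ proj₁ (principal x) → pt⊥ O x ⊆ pt⊥ O z
  ∈principal⇒pt⊥-⊆ z∈ w∈x^⊥ refl = ⊥-sym (z∈ w∈x^⊥)

  pt⊥-⊆⇒∈ : ∀ (A : L O) {a z} → a ∈ proj₁ A → pt⊥ O a ⊆ pt⊥ O z → z ∈ proj₁ A
  pt⊥-⊆⇒∈ (_ , _ , closed) a∈A a^⊥⊆z^⊥ =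
    closed λ w∈Aᵖ → ⊥-sym (a^⊥⊆z^⊥ (λ { refl → w∈Aᵖ a∈A }) refl)

  compatible⇒disjointOrthogonal : ExcludedMiddle ℓ → Compatible O → DisjointOrthogonal
  compatible⇒disjointOrthogonal lem compatible A B A∩B-empty {a} a∈A {b} b∈B with lem {a ⊥ b}
  ... | yes a⊥b = a⊥b
  ... | no a⊥̸b =
    let z , a^⊥∪b^⊥⊆z^⊥ = compatible a b a⊥̸b
    in ⊥-elim (A∩B-empty z ( pt⊥-⊆⇒∈ A a∈A (a^⊥∪b^⊥⊆z^⊥ ∘ inj₁)
                           , pt⊥-⊆⇒∈ B b∈B (a^⊥∪b^⊥⊆z^⊥ ∘ inj₂)))

  disjointOrthogonal⇒compatible : ExcludedMiddle ℓ → DisjointOrthogonal → Compatible O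
  disjointOrthogonal⇒compatible lem disjointOrthogonal x y x⊥̸y with lem
  ... | yes witness = witness
  ... | no no-witness = ⊥-elim (x⊥̸y (disjointOrthogonal (principal x) (principal y)
    (λ z (z∈x , z∈y) → no-witness (z , [ ∈principal⇒pt⊥-⊆ z∈x , ∈principal⇒pt⊥-⊆ z∈y ]))
    (∈principal x) (∈principal y)))

  ∧-distribˡ-∨-≥ : ∀ A B C → (A ∧ B) ∨ (A ∧ C) ≤ A ∧ (B ∨ C)
  ∧-distribˡ-∨-≥ A B C = ∨-least {A ∧ B} {A ∧ C} {A ∧ (B ∨ C)}
    (λ (a , b) → a , x≤x∨y B C b)
    (λ (a , c) → a , y≤x∨y B C c)

  module _ (disjointOrthogonal : DisjointOrthogonal) where
    ∧-distribˡ-∨-≤ : ∀ A B C → A ∧ (B ∨ C) ≤ (A ∧ B) ∨ (A ∧ C)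
    ∧-distribˡ-∨-≤ A B C t∈T = proj₂ (proj₂ D) (disjointOrthogonal T (¬L O D) T∩Dᵖ-empty t∈T)
      where
      T D E : L O
      T = A ∧ (B ∨ C)
      D = (A ∧ B) ∨ (A ∧ C)
      E = T ∧ ¬L O D

      E≤¬ : ∀ X → A ∧ X ≤ D → E ≤ ¬L O X
      E≤¬ X A∧X≤D = disjointOrthogonal E X
        λ w (((w∈A , _) , w∈Dᵖ) , w∈X) → ∩ᵖ-empty (proj₁ D) w (A∧X≤D (w∈A , w∈X) , w∈Dᵖ)

      T∩Dᵖ-empty : Empty (proj₁ T ∩ proj₁ (¬L O D))
      T∩Dᵖ-empty z ((z∈A , z∈B∨C) , z∈Dᵖ) = ∩ᵖ-empty ((proj₁ B ∪ proj₁ C) ᵖ) z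
        ( [ E≤¬ B (x≤x∨y (A ∧ B) (A ∧ C)) z∈E , E≤¬ C (y≤x∨y (A ∧ B) (A ∧ C)) z∈E ]
        , z∈B∨C)
        where
        z∈E : z ∈ proj₁ E
        z∈E = (z∈A , z∈B∨C) , z∈Dᵖ

    distributiveLattice : DistributiveLattice (lsuc ℓ) ℓ ℓ
    distributiveLattice = record
      { isDistributiveLattice = record
        { isLattice    = Lattice.isLattice lattice
        ; ∧-distribˡ-∨ = λ A B C → ∧-distribˡ-∨-≤ A B C , ∧-distribˡ-∨-≥ A B C
        }
      }

  disjointOrthogonal⇒isBooleanL : DisjointOrthogonal → IsBooleanL O
  disjointOrthogonal⇒isBooleanL disjointOrthogonal = Biased.isBooleanAlgebraʳ record
    { isDistributiveLattice = record
      { isLattice   = LatticeProperties.isAlgLattice lattice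
      ; ∨-distrib-∧ = ∨-distrib-∧
      ; ∧-distrib-∨ = ∧-distrib-∨
      }
    ; ∨-complementʳ = λ A → _ , λ _ {w} → ⊥-elim ∘ ᵖ-∪ᵖ-empty (proj₁ A) w
    ; ∧-complementʳ = λ A → (λ {x} → ⊥-elim ∘ ∩ᵖ-empty (proj₁ A) x) , λ ()
    ; ¬-cong        = λ (A⊆B , B⊆A) → ᵖ-anti O B⊆A , ᵖ-anti O A⊆B
    }
    where open DistributiveLatticeProperties (distributiveLattice disjointOrthogonal)

  isBooleanL⇒disjointOrthogonal : IsBooleanL O → DisjointOrthogonal
  isBooleanL⇒disjointOrthogonal isBooleanL A B A∩B-empty a∈A =
    ∨-least {A ∧ B} {A ∧ ¬L O B} {¬L O B} (λ {x} → ⊥-elim ∘ A∩B-empty x) (x∧y≤y A (¬L O B))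
      (proj₁ (∧-distribˡ-∨ A B (¬L O B)) (a∈A , proj₂ (∨-complementʳ B) _))
    where open IsBooleanAlgebra isBooleanL using (∧-distribˡ-∨; ∨-complementʳ)

theorem3p2 : {ℓ : Level} → ExcludedMiddle ℓ → (O : Orthoset ℓ) →
    Compatible O ⇔ IsBooleanL O
theorem3p2 lem O = mk⇔
  (disjointOrthogonal⇒isBooleanL O ∘ compatible⇒disjointOrthogonal O lem)
  (disjointOrthogonal⇒compatible O lem ∘ isBooleanL⇒disjointOrthogonal O)
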